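{- There is a deterministic Turing machine using logarithmic work space which, given a LIKE pattern $p$ over a finite alphabet $\Sigma$, outputs a normalized LIKE pattern equivalent to $p$ (i.e. matched by exactly the same strings in $\Sigma^*$).
   Context: A LIKE pattern over $\Sigma$ is a finite string over $\Sigma \cup \{\%, \_\}$, where $\%,\_ \notin \Sigma$ are wildcards. A string $t\in\Sigma^*$ matches the pattern if $t$ belongs to the language obtained by reading each letter of $\Sigma$ as itself, each $\_$ as any single symbol of $\Sigma$, each $\%$ as any string in $\Sigma^*$ (possibly empty), and juxtaposition as concatenation. A LIKE pattern is normalized if it contains neither of the substrings $\%\_$ and $\%\%$. -}

module Defs where

open import Data.Nat using (ℕ; zero; suc; _≤_; _*_; _+_; _≟_)
open import Data.Nat.Logarithm using (⌊log₂_⌋)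
open import Data.Fin using (Fin)
open import Data.List using (List; []; _∷_; _++_; length; [_])
open import Data.Maybe using (Maybe; just; nothing; _>>=_; maybe)
open import Data.Product using (Σ; _×_; _,_)
open import Relation.Nullary using (¬_; yes; no)
open import Relation.Binary.PropositionalEquality using (_≡_)

-- LIKE patterns over the alphabet Σ = Fin k

data PSym (k : ℕ) : Set where
  lit : Fin k → PSym k
  pct : PSym k           -- the wildcard %
  und : PSym k           -- the wildcard _

Pattern : ℕ → Set
Pattern k = List (PSym k)

data Matches {k : ℕ} : Pattern k → List (Fin k) → Set where
  m-nil  : Matches [] []
  m-lit  : ∀ {a p t} → Matches p t → Matches (lit a ∷ p) (a ∷ t)
  m-und  : ∀ {a p t} → Matches p t → Matches (und ∷ p) (a ∷ t)
  m-pct0 : ∀ {p t} → Matches p t → Matches (pct ∷ p) t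
  m-pctS : ∀ {a p t} → Matches (pct ∷ p) t → Matches (pct ∷ p) (a ∷ t)

Normalized : ∀ {k} → Pattern k → Set
Normalized {k} p =
  (¬ Σ (Pattern k) λ u → Σ (Pattern k) λ v → p ≡ u ++ (pct ∷ und ∷ v)) ×
  (¬ Σ (Pattern k) λ u → Σ (Pattern k) λ v → p ≡ u ++ (pct ∷ pct ∷ v))

Equivalent : ∀ {k} → Pattern k → Pattern k → Set
Equivalent {k} p q = (t : List (Fin k)) → (Matches p t → Matches q t) × (Matches q t → Matches p t)

-- Deterministic Turing transducers: read-only two-way input tape with
-- endmarkers, one two-way work tape (one-way infinite to the right),
-- write-only one-way output tape.

data Move : Set where
  L S R : Move

data InSym (I : Set) : Set where
  left  : InSym I          -- left endmarker (position 0)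
  right : InSym I          -- right endmarker (position length + 1)
  sym   : I → InSym I

record TM (I O : Set) : Set where
  field
    nQ    : ℕ
    nΓ    : ℕ                          -- work alphabet is Fin (suc nΓ), blank = zero
    start : Fin nQ
    -- Nothing = halt; otherwise (new state, written work symbol,
    -- input head move, work head move, optional output symbol)
    δ     : Fin nQ → InSym I → Fin (suc nΓ) →
            Maybe (Fin nQ × Fin (suc nΓ) × Move × Move × Maybe O)

module _ {I O : Set} (M : TM I O) where
  open TM M

  record Config : Set where
    constructor conf
    field
      state : Fin nQ
      ipos  : ℕ
      tape  : ℕ → Fin (suc nΓ)
      wpos  : ℕ
      out   : List O
  open Config

  readAt : List I → ℕ → InSym I
  readAt [] _ = right
  readAt (a ∷ x) zero = sym a
  readAt (a ∷ x) (suc i) = readAt x i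

  readIn : List I → ℕ → InSym I
  readIn x zero = left
  readIn x (suc i) = readAt x i

  -- input head never leaves [0, length + 1]
  moveIn : InSym I → Move → ℕ → ℕ
  moveIn _ L zero = zero
  moveIn _ L (suc i) = i
  moveIn _ S i = i
  moveIn right R i = i
  moveIn _ R i = suc i

  moveW : Move → ℕ → ℕ
  moveW L zero = zero
  moveW L (suc i) = i
  moveW S i = i
  moveW R i = suc i

  write : (ℕ → Fin (suc nΓ)) → ℕ → Fin (suc nΓ) → ℕ → Fin (suc nΓ)
  write f i g j with i ≟ j
  ... | yes _ = g
  ... | no _ = f j

  initial : Config
  initial = conf start zero (λ _ → Fin.zero) zero []
    where import Data.Fin as Fin

  step : List I → Config → Maybe Config
  step x c with δ (state c) (readIn x (ipos c)) (tape c (wpos c))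
  ... | nothing = nothing
  ... | just (q , g , mi , mw , o) =
        just (conf q (moveIn (readIn x (ipos c)) mi (ipos c))
                     (write (tape c) (wpos c) g)
                     (moveW mw (wpos c))
                     (out c ++ maybe [_] [] o))

  steps : List I → ℕ → Maybe Config
  steps x zero = just initial
  steps x (suc t) = steps x t >>= step x

  ComputesInSpace : List I → List O → ℕ → Set
  ComputesInSpace x y s =
    Σ ℕ λ T → Σ Config λ c →
      (steps x T ≡ just c) × (step x c ≡ nothing) × (out c ≡ y) ×
      ((t : ℕ) → t ≤ T → (c' : Config) → steps x t ≡ just c' → wpos c' ≤ s)

LogspaceComputes : ∀ {I O : Set} → TM I O → (List I → List O) → Set
LogspaceComputes {I} M f =
  Σ ℕ λ c → (x : List I) → ComputesInSpace M x (f x) (c * (1 + ⌊log₂ length x ⌋))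

-- Two rewrite rules preserve the language of a pattern: %% ≡ % and %_ ≡ _%.
-- Normalizing therefore means deleting repeated %s and moving each % to the
-- right across the _s that follow it. A left-to-right scan does this with a
-- single bit of memory (whether a % is pending), so it is computed by a
-- finite-state transducer, which is a Turing machine using no work space.
module Submission where

open import Defs
open import Data.Nat using (ℕ; zero; suc)
open import Data.Nat.Properties using (≤-reflexive)
open import Data.Fin using (Fin; zero; suc)
open import Data.List using (List; []; _∷_; _++_; [_]; drop)
open import Data.List.Properties using (++-assoc; ++-identityʳ)
open import Data.Maybe using (Maybe; just; nothing; maybe; _>>=_)
import Data.Maybe as Maybe
open import Data.Product using (Σ; _×_; _,_; proj₁; proj₂)
open import Function using (_$_)
open import Relation.Nullary using (¬_)
open import Relation.Binary.PropositionalEquality using (_≡_; refl; trans; cong; subst)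
import Relation.Binary.PropositionalEquality as ≡

module _ {k : ℕ} where

  infix 4 _⊆_

  _⊆_ : Pattern k → Pattern k → Set
  p ⊆ q = ∀ {t} → Matches p t → Matches q t

  ⊆-antisym : ∀ {p q : Pattern k} → p ⊆ q → q ⊆ p → Equivalent p q
  ⊆-antisym p⊆q q⊆p t = p⊆q , q⊆p

  Equivalent-refl : ∀ {p : Pattern k} → Equivalent p p
  Equivalent-refl = ⊆-antisym (λ m → m) (λ m → m)

  Equivalent-trans : ∀ {p q r : Pattern k} → Equivalent p q → Equivalent q r → Equivalent p r
  Equivalent-trans p≋q q≋r t =
    (λ m → proj₁ (q≋r t) (proj₁ (p≋q t) m)) , (λ m → proj₂ (p≋q t) (proj₂ (q≋r t) m))

  ∷-mono-⊆ : ∀ {x p q} → p ⊆ q → x ∷ p ⊆ x ∷ q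
  ∷-mono-⊆ p⊆q (m-lit m)  = m-lit (p⊆q m)
  ∷-mono-⊆ p⊆q (m-und m)  = m-und (p⊆q m)
  ∷-mono-⊆ p⊆q (m-pct0 m) = m-pct0 (p⊆q m)
  ∷-mono-⊆ p⊆q (m-pctS m) = m-pctS (∷-mono-⊆ p⊆q m)

  ∷-cong : ∀ {x} {p q : Pattern k} → Equivalent p q → Equivalent (x ∷ p) (x ∷ q)
  ∷-cong p≋q =
    ⊆-antisym (∷-mono-⊆ (λ {t} → proj₁ (p≋q t))) (∷-mono-⊆ (λ {t} → proj₂ (p≋q t)))

  pct∷pct⊆pct : ∀ {p} → pct ∷ pct ∷ p ⊆ pct ∷ p
  pct∷pct⊆pct (m-pct0 m) = m
  pct∷pct⊆pct (m-pctS m) = m-pctS (pct∷pct⊆pct m)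

  pct∷pct≋pct : ∀ {p} → Equivalent (pct ∷ pct ∷ p) (pct ∷ p)
  pct∷pct≋pct = ⊆-antisym pct∷pct⊆pct m-pct0

  pct∷und⊆und∷pct : ∀ {p} → pct ∷ und ∷ p ⊆ und ∷ pct ∷ p
  pct∷und⊆und∷pct (m-pct0 (m-und m)) = m-und (m-pct0 m)
  pct∷und⊆und∷pct (m-pctS m) with pct∷und⊆und∷pct m
  ... | m-und m′ = m-und (m-pctS m′)

  und∷pct⊆pct∷und : ∀ {p} → und ∷ pct ∷ p ⊆ pct ∷ und ∷ p
  und∷pct⊆pct∷und (m-und {a} m) = prepend a m
    where
    prepend : ∀ {p t} a → Matches (pct ∷ p) t → Matches (pct ∷ und ∷ p) (a ∷ t)
    prepend a (m-pct0 m)      = m-pct0 (m-und m)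
    prepend a (m-pctS {b} m) = m-pctS (prepend b m)

  pct∷und≋und∷pct : ∀ {p} → Equivalent (pct ∷ und ∷ p) (und ∷ pct ∷ p)
  pct∷und≋und∷pct = ⊆-antisym pct∷und⊆und∷pct und∷pct⊆pct∷und

  normalize normalizePct : Pattern k → Pattern k

  normalize []          = []
  normalize (lit a ∷ p) = lit a ∷ normalize p
  normalize (und ∷ p)   = und ∷ normalize p
  normalize (pct ∷ p)   = normalizePct p

  normalizePct []          = pct ∷ []
  normalizePct (lit a ∷ p) = pct ∷ lit a ∷ normalize p
  normalizePct (und ∷ p)   = und ∷ normalizePct p
  normalizePct (pct ∷ p)   = normalizePct p

  normalize-Equivalent : ∀ p → Equivalent p (normalize p)
  normalizePct-Equivalent : ∀ p → Equivalent (pct ∷ p) (normalizePct p)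

  normalize-Equivalent []          = Equivalent-refl
  normalize-Equivalent (lit a ∷ p) = ∷-cong (normalize-Equivalent p)
  normalize-Equivalent (und ∷ p)   = ∷-cong (normalize-Equivalent p)
  normalize-Equivalent (pct ∷ p)   = normalizePct-Equivalent p

  normalizePct-Equivalent []          = Equivalent-refl
  normalizePct-Equivalent (lit a ∷ p) = ∷-cong (∷-cong (normalize-Equivalent p))
  normalizePct-Equivalent (und ∷ p)   =
    Equivalent-trans pct∷und≋und∷pct (∷-cong (normalizePct-Equivalent p))
  normalizePct-Equivalent (pct ∷ p)   =
    Equivalent-trans pct∷pct≋pct (normalizePct-Equivalent p)

  data Normal : Pattern k → Set where
    []       : Normal []
    lit∷     : ∀ {a p} → Normal p → Normal (lit a ∷ p)
    und∷     : ∀ {p} → Normal p → Normal (und ∷ p)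
    pct∷[]   : Normal (pct ∷ [])
    pct∷lit∷ : ∀ {a p} → Normal p → Normal (pct ∷ lit a ∷ p)

  Normal-∷⁻ : ∀ {x p} → Normal (x ∷ p) → Normal p
  Normal-∷⁻ (lit∷ n)     = n
  Normal-∷⁻ (und∷ n)     = n
  Normal-∷⁻ pct∷[]       = []
  Normal-∷⁻ (pct∷lit∷ n) = lit∷ n

  Normal-++⁻ʳ : ∀ u {v} → Normal (u ++ v) → Normal v
  Normal-++⁻ʳ []      n = n
  Normal-++⁻ʳ (x ∷ u) n = Normal-++⁻ʳ u (Normal-∷⁻ n)

  Normal⇒Normalized : ∀ {p} → Normal p → Normalized p
  Normal⇒Normalized n =
      (λ { (u , v , refl) → ¬Normal-pct∷und (Normal-++⁻ʳ u n) })
    , (λ { (u , v , refl) → ¬Normal-pct∷pct (Normal-++⁻ʳ u n) })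
    where
    ¬Normal-pct∷und : ∀ {v} → ¬ Normal (pct ∷ und ∷ v)
    ¬Normal-pct∷und ()
    ¬Normal-pct∷pct : ∀ {v} → ¬ Normal (pct ∷ pct ∷ v)
    ¬Normal-pct∷pct ()

  normalize-Normal : ∀ p → Normal (normalize p)
  normalizePct-Normal : ∀ p → Normal (normalizePct p)

  normalize-Normal []          = []
  normalize-Normal (lit a ∷ p) = lit∷ (normalize-Normal p)
  normalize-Normal (und ∷ p)   = und∷ (normalize-Normal p)
  normalize-Normal (pct ∷ p)   = normalizePct-Normal p

  normalizePct-Normal []          = pct∷[]
  normalizePct-Normal (lit a ∷ p) = pct∷lit∷ (normalize-Normal p)
  normalizePct-Normal (und ∷ p)   = und∷ (normalizePct-Normal p)
  normalizePct-Normal (pct ∷ p)   = normalizePct-Normal p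

  normalize-Normalized : ∀ p → Normalized (normalize p)
  normalize-Normalized p = Normal⇒Normalized (normalize-Normal p)

drop-suc : ∀ {A : Set} (xs : List A) j {a rest} → drop j xs ≡ a ∷ rest → drop (suc j) xs ≡ rest
drop-suc (b ∷ xs) zero    refl = refl
drop-suc (b ∷ xs) (suc j) e    = drop-suc xs j e

WorkHeadStationary : ∀ {I O : Set} → TM I O → Set
WorkHeadStationary M =
  ∀ q r g {q′ g′ mi mw o} → TM.δ M q r g ≡ just (q′ , g′ , mi , mw , o) → mw ≡ S

module _ {I O : Set} (M : TM I O) where
  open TM M
  open Config

  readAt-drop : ∀ xs j → readAt M xs j ≡ readAt M (drop j xs) 0
  readAt-drop []       zero    = refl
  readAt-drop []       (suc j) = refl
  readAt-drop (a ∷ xs) zero    = refl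
  readAt-drop (a ∷ xs) (suc j) = readAt-drop xs j

  module _ (x : List I) where

    data Halts : Config M → List O → Set where
      halt : ∀ {c y} → step M x c ≡ nothing → out c ≡ y → Halts c y
      next : ∀ {c c′ y} → step M x c ≡ just c′ → Halts c′ y → Halts c y

    step-just : ∀ {c r q′ g mi mw o} → readIn M x (ipos c) ≡ r →
                δ (state c) r (tape c (wpos c)) ≡ just (q′ , g , mi , mw , o) →
                step M x c ≡ just (conf q′ (moveIn M r mi (ipos c)) (write M (tape c) (wpos c) g)
                                        (moveW M mw (wpos c)) (out c ++ maybe [_] [] o))
    step-just refl e rewrite e = refl

    step-nothing : ∀ {c r} → readIn M x (ipos c) ≡ r →
                   δ (state c) r (tape c (wpos c)) ≡ nothing → step M x c ≡ nothing
    step-nothing refl e rewrite e = refl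

    Halts⇒steps : ∀ {t c y} → steps M x t ≡ just c → Halts c y →
                  Σ ℕ λ T → Σ (Config M) λ c′ →
                    steps M x T ≡ just c′ × step M x c′ ≡ nothing × out c′ ≡ y
    Halts⇒steps {t} e (halt h o) = t , _ , e , h , o
    Halts⇒steps {t} e (next s h) = Halts⇒steps {suc t} (trans (cong (_>>= step M x) e) s) h

    module _ (stationary : WorkHeadStationary M) where

      step-wpos : ∀ {c c′} → step M x c ≡ just c′ → wpos c′ ≡ wpos c
      step-wpos {conf q i tp w _} s with δ q (readIn M x i) (tp w) in e
      ... | just _ with refl ← s | refl ← stationary q (readIn M x i) (tp w) e = refl

      steps-wpos : ∀ t {c} → steps M x t ≡ just c → wpos c ≡ 0
      steps-wpos zero    refl = refl
      steps-wpos (suc t) s with steps M x t in e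
      ... | just c = trans (step-wpos s) (steps-wpos t e)

      Halts⇒ComputesInSpace₀ : ∀ {y} → Halts (initial M) y → ComputesInSpace M x y 0
      Halts⇒ComputesInSpace₀ h =
        let T , c , reach , stop , output = Halts⇒steps {t = 0} refl h
        in  T , c , reach , stop , output ,
            λ t _ _ e → ≤-reflexive (steps-wpos t e)

Transducer : Set → Set → ℕ → Set
Transducer I O n = Fin n → InSym I → Maybe (Fin n × Move × Maybe O)

transducerTM : ∀ {I O n} → Fin n → Transducer I O n → TM I O
transducerTM {n = n} q₀ τ = record
  { nQ    = n
  ; nΓ    = 0
  ; start = q₀
  ; δ     = λ q r _ → Maybe.map (λ (q′ , mi , o) → q′ , zero , mi , S , o) (τ q r)
  }

module TransducerTM {I O : Set} {n} (q₀ : Fin n) (τ : Transducer I O n) where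
  open Config

  M : TM I O
  M = transducerTM q₀ τ

  stationary : WorkHeadStationary M
  stationary q r _ e with τ q r | e
  ... | just _ | refl = refl

  module _ {x : List I} where

    transducer-next : ∀ {c r q′ mi o y} →
      readIn M x (ipos c) ≡ r → τ (state c) r ≡ just (q′ , mi , o) →
      Halts M x (conf q′ (moveIn M r mi (ipos c)) (write M (tape c) (wpos c) zero) (wpos c)
                      (out c ++ maybe [_] [] o)) y →
      Halts M x c y
    transducer-next read e = next (step-just M x read (cong (Maybe.map _) e))

    transducer-halt : ∀ {c r y} →
      readIn M x (ipos c) ≡ r → τ (state c) r ≡ nothing → out c ≡ y → Halts M x c y
    transducer-halt read e = halt (step-nothing M x read (cong (Maybe.map _) e))

-- In state pending a % has been read but not yet written.
pattern copying = zero
pattern pending = suc zero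

module _ {k : ℕ} where

  normalizerTransducer : Transducer (PSym k) (PSym k) 2
  normalizerTransducer copying left          = just (copying , R , nothing)
  normalizerTransducer copying right         = nothing
  normalizerTransducer copying (sym pct)     = just (pending , R , nothing)
  normalizerTransducer copying (sym s)       = just (copying , R , just s)
  normalizerTransducer pending left          = nothing
  normalizerTransducer pending right         = just (copying , S , just pct)
  normalizerTransducer pending (sym (lit a)) = just (copying , S , just pct)
  normalizerTransducer pending (sym und)     = just (pending , R , just und)
  normalizerTransducer pending (sym pct)     = just (pending , R , nothing)

  normalizer : TM (PSym k) (PSym k)
  normalizer = transducerTM copying normalizerTransducer

  open TransducerTM copying normalizerTransducer

  module _ (x : Pattern k) where

    readIn-suc : ∀ {j rest} → drop j x ≡ rest →
                 readIn normalizer x (suc j) ≡ readAt normalizer rest 0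
    readIn-suc {j} e = trans (readAt-drop normalizer x j) (cong (λ r → readAt normalizer r 0) e)

    reassoc : ∀ {c} o w {y} →
              Halts normalizer x c ((o ++ w) ++ y) → Halts normalizer x c (o ++ (w ++ y))
    reassoc o w = subst (Halts normalizer x _) (++-assoc o w _)

    run-copying : ∀ rest j tp o → drop j x ≡ rest →
                  Halts normalizer x (conf copying (suc j) tp 0 o) (o ++ normalize rest)
    run-pending : ∀ rest j tp o → drop j x ≡ rest →
                  Halts normalizer x (conf pending (suc j) tp 0 o) (o ++ normalizePct rest)

    run-copying [] j _ o e =
      transducer-halt (readIn-suc e) refl (≡.sym (++-identityʳ o))
    run-copying (lit a ∷ rest) j _ o e =
      transducer-next (readIn-suc e) refl $ reassoc o [ lit a ] $
        run-copying rest (suc j) _ _ (drop-suc x j e)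
    run-copying (und ∷ rest) j _ o e =
      transducer-next (readIn-suc e) refl $ reassoc o [ und ] $
        run-copying rest (suc j) _ _ (drop-suc x j e)
    run-copying (pct ∷ rest) j _ o e =
      transducer-next (readIn-suc e) refl $ reassoc o [] $
        run-pending rest (suc j) _ _ (drop-suc x j e)

    run-pending [] j _ o e =
      transducer-next (readIn-suc e) refl $ reassoc o [ pct ] $
        run-copying [] j _ _ e
    run-pending (lit a ∷ rest) j _ o e =
      transducer-next (readIn-suc e) refl $ reassoc o [ pct ] $
        run-copying (lit a ∷ rest) j _ _ e
    run-pending (und ∷ rest) j _ o e =
      transducer-next (readIn-suc e) refl $ reassoc o [ und ] $
        run-pending rest (suc j) _ _ (drop-suc x j e)
    run-pending (pct ∷ rest) j _ o e =
      transducer-next (readIn-suc e) refl $ reassoc o [] $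
        run-pending rest (suc j) _ _ (drop-suc x j e)

    normalizer-halts : Halts normalizer x (initial normalizer) (normalize x)
    normalizer-halts = transducer-next refl refl (run-copying x 0 _ [] refl)

lemma1 : (k : ℕ) → Σ (TM (PSym k) (PSym k)) λ M → Σ (Pattern k → Pattern k) λ f →
           LogspaceComputes M f × ((p : Pattern k) → Normalized (f p) × Equivalent p (f p))
lemma1 k =
  normalizer , normalize ,
  (0 , λ x → Halts⇒ComputesInSpace₀ normalizer x
              (TransducerTM.stationary copying normalizerTransducer) (normalizer-halts x)) ,
  λ p → normalize-Normalized p , normalize-Equivalent p
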